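{- Assume the univalence axiom. Then for every pair of small $P$-algebras $C,D$, the canonical function $\mathsf{ext}^{\mathsf{Alg}}_{C,D}:\mathsf{Id}_{\mathsf{Alg}}(C,D)\to\mathsf{AlgEquiv}(C,D)$ (defined by $\mathsf{Id}$-elimination, sending the reflexivity path on $C$ to the identity $P$-algebra equivalence on $C$) is an equivalence of types.
   Context: Work in the intensional Martin-Löf type theory $\mathcal{H}$ with $\Sigma$-types, $\Pi$-types (with judgemental $\eta$), identity types and a universe $\mathsf{U}$ (à la Russell) closed under $\Sigma,\Pi,\mathsf{Id}$, plus function extensionality; no UIP. $\mathsf{iscontr}(X):=(\Sigma x:X)(\Pi y:X)\mathsf{Id}(x,y)$; $\mathsf{hfiber}(f,y):=(\Sigma x:A)\mathsf{Id}(fx,y)$; $f$ is an equivalence if $\mathsf{isequiv}(f):=(\Pi y)\mathsf{iscontr}(\mathsf{hfiber}(f,y))$ is inhabited; $\mathsf{Equiv}(A,B):=(\Sigma f:A\to B)\mathsf{isequiv}(f)$. Univalence axiom: for all $X,Y:\mathsf{U}$ the canonical map $\mathsf{Id}_{\mathsf{U}}(X,Y)\to\mathsf{Equiv}(X,Y)$ (sending reflexivity to the identity) is an equivalence. Fix $A:\mathsf{U}$, $B:A\to\mathsf{U}$; $PC:=(\Sigma x:A)(B(x)\to C)$, $Pf(x,u)=(x,f\circ u)$ (defined by $\Sigma$-elimination). $\mathsf{Alg}:=(\Sigma C:\mathsf{U})(PC\to C)$; $\mathsf{Alg}(C,D):=(\Sigma f:C\to D)\mathsf{Id}(f\circ\sup_C,\sup_D\circ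 Pf)$. Composite of $(f,\bar f):C\to D$, $(g,\bar g):D\to E$: $g\circ f$ with path obtained by concatenating $g\circ\bar f$, $\bar g\circ Pf$ and $\sup_E$ whiskered with the canonical path $\mathsf{Id}(Pg\circ Pf,P(g\circ f))$; identity: $1_C$ with the canonical path from $\mathsf{Id}(P(1_C),1_{PC})$. $\mathsf{isalgequiv}(f):=(\Sigma g:\mathsf{Alg}(D,C))\mathsf{Id}_{\mathsf{Alg}(C,C)}(gf,1_C)\times(\Sigma h:\mathsf{Alg}(D,C))\mathsf{Id}_{\mathsf{Alg}(D,D)}(fh,1_D)$; $\mathsf{AlgEquiv}(C,D):=(\Sigma f:\mathsf{Alg}(C,D))\mathsf{isalgequiv}(f)$. -}

{-# OPTIONS --without-K #-}
module Defs where

open import Level using (Level; _⊔_; Setω)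
open import Function using (_∘_; id)
open import Data.Product using (Σ; _×_; _,_; proj₁; proj₂)
open import Relation.Binary.PropositionalEquality using (_≡_; refl; trans; cong)

iscontr : ∀ {ℓ} → Set ℓ → Set ℓ
iscontr X = Σ X (λ x → (y : X) → x ≡ y)

hfiber : ∀ {a b} {X : Set a} {Y : Set b} → (X → Y) → Y → Set (a ⊔ b)
hfiber {X = X} f y = Σ X (λ x → f x ≡ y)

isequiv : ∀ {a b} {X : Set a} {Y : Set b} → (X → Y) → Set (a ⊔ b)
isequiv {Y = Y} f = (y : Y) → iscontr (hfiber f y)

Equiv : ∀ {a b} → Set a → Set b → Set (a ⊔ b)
Equiv X Y = Σ (X → Y) isequiv

idIsEquiv : ∀ {a} {X : Set a} → isequiv (λ (x : X) → x)
idIsEquiv y = (y , refl) , λ { (x , refl) → refl }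

idtoeqv : {X Y : Set} → X ≡ Y → Equiv X Y
idtoeqv refl = (λ x → x) , idIsEquiv

Univalence : Set₁
Univalence = (X Y : Set) → isequiv (idtoeqv {X} {Y})

FunExt : Setω
FunExt = ∀ {a b} {X : Set a} {Y : X → Set b} {f g : (x : X) → Y x}
       → ((x : X) → f x ≡ g x) → f ≡ g

module _ (A : Set) (B : A → Set) where

  P : Set → Set
  P C = Σ A (λ x → B x → C)

  Pmap : {C D : Set} → (C → D) → P C → P D
  Pmap f (x , u) = x , (f ∘ u)

  Alg : Set₁
  Alg = Σ Set (λ C → P C → C)

  AlgHom : Alg → Alg → Set
  AlgHom (C , supC) (D , supD) =
    Σ (C → D) (λ f → (f ∘ supC) ≡ (supD ∘ Pmap f))

  -- canonical paths (Σ has η in Agda, so these hold by reflexivity)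
  Pcomp : {C D E : Set} (f : C → D) (g : D → E) →
          (Pmap g ∘ Pmap f) ≡ Pmap (g ∘ f)
  Pcomp f g = refl

  Pid : {C : Set} → Pmap (λ (c : C) → c) ≡ (λ p → p)
  Pid = refl

  compAlg : {C D E : Alg} → AlgHom D E → AlgHom C D → AlgHom C E
  compAlg {C , supC} {D , supD} {E , supE} (g , gbar) (f , fbar) =
    (g ∘ f) ,
    trans (cong (g ∘_) fbar)
      (trans (cong (_∘ Pmap f) gbar)
             (cong (supE ∘_) (Pcomp f g)))

  idAlg : (C : Alg) → AlgHom C C
  idAlg (C , supC) = (λ c → c) , cong (supC ∘_) (sym' Pid)
    where
      sym' : ∀ {ℓ} {X : Set ℓ} {x y : X} → x ≡ y → y ≡ x
      sym' refl = refl

  isalgequiv : {C D : Alg} → AlgHom C D → Set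
  isalgequiv {C} {D} f =
    Σ (AlgHom D C) (λ g → compAlg {C} {D} {C} g f ≡ idAlg C)
    × Σ (AlgHom D C) (λ h → compAlg {D} {C} {D} f h ≡ idAlg D)

  AlgEquiv : Alg → Alg → Set
  AlgEquiv C D = Σ (AlgHom C D) (isalgequiv {C} {D})

  idAlgEquiv : (C : Alg) → AlgEquiv C C
  idAlgEquiv C = idAlg C , (idAlg C , refl) , (idAlg C , refl)

  extAlg : (C D : Alg) → C ≡ D → AlgEquiv C D
  extAlg C .C refl = idAlgEquiv C

{-# OPTIONS --without-K #-}
-- Univalence turns an algebra equivalence into a path between carriers; over
-- that path the structure map of the target is transported to the source, and
-- what remains of an algebra equivalence from C to itself that lies over the
-- identity is a pair of fibres of composition with 1_C, which are contractible
-- because 1_C is a unit for composition.  Hence the pairs (D , e : AlgEquiv C D)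
-- form a contractible type, and the fundamental theorem of identity types
-- makes extAlg an equivalence.
module Submission where

open import Defs
open import Level using (Level)
open import Function using (_∘_; id)
open import Data.Product using (Σ; _×_; _,_; proj₁; proj₂)
open import Relation.Binary.PropositionalEquality
  using (_≡_; refl; trans; sym; cong; cong₂; subst; trans-symˡ; trans-reflʳ; cong-id)
open import Function.Bundles using (mk↔ₛ′)
open import Function.Properties.Inverse.HalfAdjointEquivalence using (_≃_; ↔⇒≃)

private
  variable
    a b ℓ : Level
    X Y : Set a

iscontr⇒≡ : iscontr X → (x y : X) → x ≡ y
iscontr⇒≡ (_ , contraction) x y = trans (sym (contraction x)) (contraction y)

iscontr⇒≡-refl : (k : iscontr X) (x : X) → iscontr⇒≡ k x x ≡ refl
iscontr⇒≡-refl (_ , contraction) x = trans-symˡ (contraction x)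

×-iscontr : iscontr X → iscontr Y → iscontr (X × Y)
×-iscontr (x , p) (y , q) = (x , y) , λ { (x′ , y′) → cong₂ _,_ (p x′) (q y′) }

invertible⇒isequiv : (f : X → Y) (g : Y → X) →
                     (∀ x → g (f x) ≡ x) → (∀ y → f (g y) ≡ y) → isequiv f
invertible⇒isequiv f g η ε y = (from y , right-inverse-of y) , contraction y
  where
  open _≃_ (↔⇒≃ (mk↔ₛ′ f g ε η))
  fibre-path : ∀ {x′ x} (u : x′ ≡ x) → _≡_ {A = hfiber f (f x)} (x′ , cong f u) (x , refl)
  fibre-path refl = refl
  contraction : ∀ y (w : hfiber f y) → (from y , right-inverse-of y) ≡ w
  contraction .(f x) (x , refl) =
    trans (cong (from (f x) ,_) (sym (left-right x))) (fibre-path (left-inverse-of x))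

biinvertible⇒isequiv : (f : X → Y) (g h : Y → X) →
                       (∀ x → g (f x) ≡ x) → (∀ y → f (h y) ≡ y) → isequiv f
biinvertible⇒isequiv f g h η ε = invertible⇒isequiv f g η ε′
  where
  ε′ : ∀ y → f (g y) ≡ y
  ε′ y = trans (cong (f ∘ g) (sym (ε y))) (trans (cong f (η (h y))) (ε y))

∼id⇒isequiv : (φ : X → X) → (∀ x → φ x ≡ x) → isequiv φ
∼id⇒isequiv φ φ∼id = invertible⇒isequiv φ id φ∼id φ∼id

fundamental-theorem : {X : Set a} (E : X → Set b) (x₀ : X)
                      (ext : (y : X) → x₀ ≡ y → E y) →
                      iscontr (Σ X E) → (y : X) → isequiv (ext y)
fundamental-theorem {X = X} E x₀ ext k y = invertible⇒isequiv (ext y) retract retract-ext ext-retract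
  where
  centre : Σ X E
  centre = x₀ , ext x₀ refl
  retract : E y → x₀ ≡ y
  retract e = cong proj₁ (iscontr⇒≡ k centre (y , e))
  retract-ext : ∀ p → retract (ext y p) ≡ p
  retract-ext refl = cong (cong proj₁) (iscontr⇒≡-refl k centre)
  ext-cong-proj₁ : ∀ {y e} (q : centre ≡ (y , e)) → ext y (cong proj₁ q) ≡ e
  ext-cong-proj₁ refl = refl
  ext-retract : ∀ e → ext y (retract e) ≡ e
  ext-retract e = ext-cong-proj₁ (iscontr⇒≡ k centre (y , e))

Equiv-induction : Univalence → {X : Set} (Q : (Y : Set) → Equiv X Y → Set ℓ) →
                  Q X (idtoeqv refl) → (Y : Set) (e : Equiv X Y) → Q Y e
Equiv-induction ua {X} Q q-refl Y e = subst (Q Y) idtoeqv-p≡e (from-path p)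
  where
  p : X ≡ Y
  p = proj₁ (proj₁ (ua X Y e))
  idtoeqv-p≡e : idtoeqv p ≡ e
  idtoeqv-p≡e = proj₂ (proj₁ (ua X Y e))
  from-path : ∀ {Y} (p : X ≡ Y) → Q Y (idtoeqv p)
  from-path refl = q-refl

module _ (A : Set) (B : A → Set) where

  -- No function extensionality is needed: P preserves identities and
  -- composition judgementally, so the unit laws only cancel reflexivity paths.
  compAlg-identityʳ : {C D : Alg A B} (f : AlgHom A B C D) →
                      compAlg A B {C} {C} {D} f (idAlg A B C) ≡ f
  compAlg-identityʳ (f , f̄) = cong (f ,_) (trans (trans-reflʳ _) (cong-id f̄))

  compAlg-identityˡ : {C D : Alg A B} (f : AlgHom A B C D) →
                      compAlg A B {C} {D} {D} (idAlg A B D) f ≡ f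
  compAlg-identityˡ (f , f̄) = cong (f ,_) (trans (trans-reflʳ _) (cong-id f̄))

  isalgequiv-idAlg-iscontr : (C : Alg A B) → iscontr (isalgequiv A B {C} {C} (idAlg A B C))
  isalgequiv-idAlg-iscontr C =
    ×-iscontr (∼id⇒isequiv _ (compAlg-identityʳ {C} {C}) (idAlg A B C))
              (∼id⇒isequiv _ (compAlg-identityˡ {C} {C}) (idAlg A B C))

  AlgEquiv⇒isequiv : {C D : Alg A B} (e : AlgEquiv A B C D) → isequiv (proj₁ (proj₁ e))
  AlgEquiv⇒isequiv ((f , _) , ((g , _) , gf≡1) , ((h , _) , fh≡1)) =
    biinvertible⇒isequiv f g h (λ x → cong (λ k → proj₁ k x) gf≡1)
                               (λ y → cong (λ k → proj₁ k y) fh≡1)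

  AlgEquiv-total-iscontr : Univalence → (C : Alg A B) → iscontr (Σ (Alg A B) (AlgEquiv A B C))
  AlgEquiv-total-iscontr ua C@(C₀ , supC) = (C , idAlgEquiv A B C) , contraction
    where
    Q : (Y : Set) → Equiv C₀ Y → Set₁
    Q Y (f , _) = (supD : P A B Y → Y) (f̄ : f ∘ supC ≡ supD ∘ Pmap A B f)
                  (ie : isalgequiv A B {C} {Y , supD} (f , f̄)) →
                  _≡_ {A = Σ (Alg A B) (AlgEquiv A B C)}
                      (C , idAlgEquiv A B C) ((Y , supD) , (f , f̄) , ie)
    Q-idtoeqv : Q C₀ (idtoeqv refl)
    Q-idtoeqv .supC refl ie =
      cong (λ ie → C , idAlg A B C , ie)
           (iscontr⇒≡ (isalgequiv-idAlg-iscontr C) (proj₂ (idAlgEquiv A B C)) ie)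
    contraction : (z : Σ (Alg A B) (AlgEquiv A B C)) → (C , idAlgEquiv A B C) ≡ z
    contraction ((D₀ , supD) , e@((f , f̄) , ie)) =
      Equiv-induction ua Q Q-idtoeqv D₀ (f , AlgEquiv⇒isequiv e) supD f̄ ie

theorem5p15 : (A : Set) (B : A → Set) → FunExt → Univalence →
              (C D : Alg A B) → isequiv (extAlg A B C D)
theorem5p15 A B _ ua C =
  fundamental-theorem (AlgEquiv A B C) C (extAlg A B C) (AlgEquiv-total-iscontr A B ua C)
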